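{- Let $m,q \geq 3$, let $\zeta$ be a polarity of the projective space $\mathrm{PG}(m-1,q)$, and let $x^\ast$ be a point of $\mathrm{PG}(m-1,q)$ not contained in the hyperplane $H^\ast := (x^\ast)^\zeta$. Let $\Gamma$ be the graph with vertex set $V := \mathrm{PG}(m-1,q) \setminus (H^\ast \cup \{x^\ast\})$, in which two (possibly equal) vertices $x$ and $y$ are adjacent whenever $x \in y^\zeta$. Then $\Gamma$ is a proper LDDG whose canonical partition consists of the classes of the equivalence relation $R$ on $V$ defined by $(x,y) \in R$ if and only if $x^\ast x = x^\ast y$ (where $x^\ast x$ denotes the line through $x^\ast$ and $x$).
   Context: $\mathrm{PG}(m-1,q)$ is the projective space of the $m$-dimensional vector space $\mathbb{F}_q^m$: its points are the 1-dimensional subspaces, and a projective subspace of dimension $i$ is the set of points contained in an $(i+1)$-dimensional vector subspace; lines are subspaces of dimension 1, hyperplanes of dimension $m-2$. A polarity $\zeta$ is a bijection of the set of subspaces that reverses inclusion and satisfies $\zeta^2=\mathrm{id}$; for a point $x$, $x^\zeta$ is a hyperplane, and $x \in y^\zeta$ iff $y \in x^\zeta$. Graphs here are finite, undirected, without multiple edges, but loops are allowed: a vertex may be adjacent to itself. For a vertex $x$, $\Gamma(x)$ is the set of vertices adjacent to $x$ (containing $x$ iff $x$ has a loop), and the degree of $x$ is $|\Gamma(x)|$ (a loop contributes exactly 1). Common neighbours of $x,y$ are the elements of $\Gamma(x)\cap\Gamma(y)$. A $k$-regular graph on $v$ vertices is an LDDG with parameters $(v,k,\lambda_1,\lambda_2,m,n)$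 if its vertex set can be partitioned into $m$ classes of size $n$ such that any two distinct vertices of the same class have exactly $\lambda_1$ common neighbours and any two vertices of different classes have exactly $\lambda_2$ common neighbours. It is proper if $m,n \geq 2$ and $\lambda_1 \neq \lambda_2$; the partition is then uniquely determined and called the canonical partition. -}

module Defs where

open import Level using (0ℓ)
open import Data.Nat using (ℕ; _≤_)
open import Data.Fin using (Fin)
open import Data.Bool using (Bool; true)
open import Data.Unit using (⊤)
open import Data.Product using (Σ; ∃; _×_; _,_)
open import Data.Vec using (Vec; replicate; zipWith; map)
open import Data.Vec.Relation.Binary.Pointwise.Inductive using (Pointwise)
open import Relation.Nullary using (¬_)
open import Relation.Binary using (Decidable; IsEquivalence)
open import Relation.Binary.PropositionalEquality as ≡ using (_≡_)
open import Algebra.Bundles using (CommutativeRing)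
open import Function.Bundles using (Inverse; _⇔_)

record FiniteField (q : ℕ) : Set₁ where
  field
    commRing : CommutativeRing 0ℓ 0ℓ
  open CommutativeRing commRing public
  field
    1≉0     : ¬ (1# ≈ 0#)
    inverse : ∀ x → ¬ (x ≈ 0#) → ∃ λ y → x * y ≈ 1#
    _≟_     : Decidable _≈_
    enum    : Inverse (≡.setoid (Fin q)) setoid

module PG {q : ℕ} (F : FiniteField q) (m : ℕ) where
  open FiniteField F

  Vector : Set
  Vector = Vec Carrier m

  _≋_ : Vector → Vector → Set
  _≋_ = Pointwise _≈_

  𝟎 : Vector
  𝟎 = replicate m 0#

  _⊕_ : Vector → Vector → Vector
  _⊕_ = zipWith _+_

  _⊙_ : Carrier → Vector → Vector
  c ⊙ v = map (c *_) v

  record Subspace : Set where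
    field
      mem   : Vector → Bool
      resp  : ∀ {u v} → u ≋ v → mem u ≡ mem v
      𝟎∈    : mem 𝟎 ≡ true
      ⊕∈    : ∀ {u v} → mem u ≡ true → mem v ≡ true → mem (u ⊕ v) ≡ true
      ⊙∈    : ∀ c {u} → mem u ≡ true → mem (c ⊙ u) ≡ true
  open Subspace public

  _∈_ : Vector → Subspace → Set
  v ∈ S = mem S v ≡ true

  _⊆_ : Subspace → Subspace → Set
  S ⊆ T = ∀ v → v ∈ S → v ∈ T

  _≐_ : Subspace → Subspace → Set
  S ≐ T = (S ⊆ T) × (T ⊆ S)

  -- points of PG(m-1,q): 1-dimensional subspaces (spanned by a nonzero vector)
  IsPoint : Subspace → Set
  IsPoint S = ∃ λ u → ¬ (u ≋ 𝟎) × (∀ w → (w ∈ S) ⇔ (∃ λ c → w ≋ (c ⊙ u)))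

  -- vectors of the join (sum) of two subspaces; for two distinct points
  -- this is the line through them
  InJoin : Subspace → Subspace → Vector → Set
  InJoin S T w = ∃ λ s → ∃ λ t → (s ∈ S) × (t ∈ T) × (w ≋ (s ⊕ t))

  -- A polarity: an inclusion-reversing involution on the set of subspaces
  -- (an involution is automatically a bijection).
  record Polarity : Set where
    field
      ζ          : Subspace → Subspace
      antitone   : ∀ S T → S ⊆ T → ζ T ⊆ ζ S
      involutive : ∀ S → ζ (ζ S) ≐ S

  module Γ (P : Polarity) (x* : Subspace) where
    open Polarity P

    Vertex : Set
    Vertex = Σ Subspace λ x → IsPoint x × ¬ (x ⊆ ζ x*) × ¬ (x ≐ x*)

    _≈V_ : Vertex → Vertex → Set
    (x , _) ≈V (y , _) = x ≐ y

    Adj : Vertex → Vertex → Set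
    Adj (x , _) (y , _) = x ⊆ ζ y

    R : Vertex → Vertex → Set
    R (x , _) (y , _) = ∀ w → InJoin x* x w ⇔ InJoin x* y w

HasSize : {A : Set} → (A → A → Set) → (A → Set) → ℕ → Set
HasSize {A} _~_ P n =
  Σ (Fin n → A) λ f →
    (∀ i → P (f i)) ×
    (∀ i j → f i ~ f j → i ≡ j) ×
    (∀ a → P a → ∃ λ i → f i ~ a)

NumClasses : {A : Set} → (A → A → Set) → ℕ → Set
NumClasses {A} R n =
  Σ (Fin n → A) λ r →
    (∀ i j → R (r i) (r j) → i ≡ j) ×
    (∀ a → ∃ λ i → R (r i) a)

record IsLDDG {A : Set} (_~_ : A → A → Set) (Adj : A → A → Set)
              (Part : A → A → Set) (v k λ₁ λ₂ m n : ℕ) : Set where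
  field
    vertices    : HasSize _~_ (λ _ → ⊤) v
    regular     : ∀ x → HasSize _~_ (Adj x) k
    partition   : IsEquivalence Part
    classSize   : ∀ x → HasSize _~_ (Part x) n
    numClasses  : NumClasses Part m
    sameClass   : ∀ x y → Part x y → ¬ (x ~ y) →
                  HasSize _~_ (λ z → Adj x z × Adj y z) λ₁
    diffClass   : ∀ x y → ¬ Part x y →
                  HasSize _~_ (λ z → Adj x z × Adj y z) λ₂

record IsProperLDDG {A : Set} (_~_ : A → A → Set) (Adj : A → A → Set)
                    (Part : A → A → Set) (v k λ₁ λ₂ m n : ℕ) : Set where
  field
    lddg : IsLDDG _~_ Adj Part v k λ₁ λ₂ m n
    m≥2  : 2 ≤ m
    n≥2  : 2 ≤ n
    λ₁≢λ₂ : ¬ (λ₁ ≡ λ₂)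

{-# OPTIONS --safe #-}
module Submission where

-- The polar H = x*^ζ of the point x* = ⟨a⟩ is a hyperplane not through a, so every point
-- outside H is spanned by exactly one vector of the affine hyperplane a + H; through these
-- representatives the vertices lying in a subspace W correspond to a translate of W ∩ H.
-- Cutting a subspace not contained in the hyperplane y^ζ of a point y by y^ζ divides its size
-- by q.  Hence |H| = q^(m-1), the neighbourhood x^ζ of a vertex x has q^(m-2) vertices, and
-- for x, y on different lines through x* the common neighbourhood x^ζ ∩ y^ζ has q^(m-3).
-- The class of x consists of the q - 1 points of the line x*x other than x* and x*x ∩ H.
-- If x ≠ y lie on one line through x*, then x* ∈ xy, so a common neighbour z would satisfy
-- x* ⊆ z^ζ, i.e. z ⊆ H: in that case there are no common neighbours at all.

open import Defs
open import Data.Nat using (ℕ; _≤_)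
open import Data.Product using (∃; _,_; proj₁)
open import Relation.Nullary using (¬_)
import Data.Nat as ℕ
import Data.Nat.Properties as ℕ

module Counting where
  open import Level using (0ℓ)
  open import Data.Nat using (ℕ; zero; suc; _≤_; _<_; s≤s; z≤n)
  open import Data.Nat.Properties using (≤-antisym; <⇒≱)
  open import Data.Fin using (Fin; zero; suc; punchIn; punchOut; combine; remQuot)
  open import Data.Fin.Properties
    using (any?; injective⇒≤; punchIn-injective; punchIn-punchOut; punchInᵢ≢i)
    using (remQuot-combine; combine-remQuot)
  open import Data.Product using (Σ; ∃; _×_; _,_; proj₁; proj₂; uncurry; map₂)
  open import Data.Sum using (_⊎_; inj₁; inj₂)
  open import Data.Unit using (⊤; tt)
  open import Data.Empty using (⊥-elim)
  open import Function using (_∘_)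
  open import Function.Bundles using (_⇔_; Equivalence)
  open import Relation.Nullary using (¬_; Dec; yes; no; map′)
  open import Relation.Unary using (Pred; Decidable)
  open import Relation.Binary using (Rel; IsEquivalence; _Respects_)
  import Relation.Binary as B
  open import Relation.Binary.PropositionalEquality
    using (_≡_; refl; sym; cong; cong₂; subst; module ≡-Reasoning)

  module _ {A : Set} {_~_ : Rel A 0ℓ} (~-isEquivalence : IsEquivalence _~_) where
    open IsEquivalence ~-isEquivalence renaming (refl to ~-refl; sym to ~-sym; trans to ~-trans)

    HasSize-≤ : ∀ {P Q : Pred A 0ℓ} {n k} → (∀ a → P a → Q a) →
                HasSize _~_ P n → HasSize _~_ Q k → n ≤ k
    HasSize-≤ P⊆Q (f , fP , f-inj , _) (g , _ , g-inj , g-onto) = injective⇒≤ index-injective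
      where
      index : ∀ i → ∃ λ j → g j ~ f i
      index i = g-onto (f i) (P⊆Q _ (fP i))
      index-injective : ∀ {i j} → proj₁ (index i) ≡ proj₁ (index j) → i ≡ j
      index-injective {i} {j} eq = f-inj i j
        (~-trans (~-sym (proj₂ (index i))) (subst (λ l → g l ~ f j) (sym eq) (proj₂ (index j))))

    HasSize-unique : ∀ {P : Pred A 0ℓ} {n k} → HasSize _~_ P n → HasSize _~_ P k → n ≡ k
    HasSize-unique sₙ sₖ =
      ≤-antisym (HasSize-≤ (λ _ p → p) sₙ sₖ) (HasSize-≤ (λ _ p → p) sₖ sₙ)

    HasSize-cong : ∀ {P Q : Pred A 0ℓ} {n} → (∀ a → P a → Q a) → (∀ a → Q a → P a) →
                   HasSize _~_ P n → HasSize _~_ Q n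
    HasSize-cong P⊆Q Q⊆P (f , fP , f-inj , f-onto) =
      f , (λ i → P⊆Q _ (fP i)) , f-inj , λ a Qa → f-onto a (Q⊆P a Qa)

    HasSize-⇔ : ∀ {P Q : Pred A 0ℓ} {n} → (∀ a → P a ⇔ Q a) → HasSize _~_ P n → HasSize _~_ Q n
    HasSize-⇔ P⇔Q = HasSize-cong (λ a → Equivalence.to (P⇔Q a)) (λ a → Equivalence.from (P⇔Q a))

    HasSize-∅ : ∀ {P : Pred A 0ℓ} → (∀ a → ¬ P a) → HasSize _~_ P 0
    HasSize-∅ ¬P = (λ ()) , (λ ()) , (λ ()) , λ a Pa → ⊥-elim (¬P a Pa)

    HasSize-insert : ∀ {P : Pred A 0ℓ} {n a} → P Respects _~_ → ¬ P a →
                     HasSize _~_ P n → HasSize _~_ (λ x → a ~ x ⊎ P x) (suc n)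
    HasSize-insert {a = a} P-resp ¬Pa (f , fP , f-inj , f-onto) = g , gP , g-inj , g-onto
      where
      g : Fin _ → A
      g zero    = a
      g (suc i) = f i
      gP : ∀ i → a ~ g i ⊎ _
      gP zero    = inj₁ ~-refl
      gP (suc i) = inj₂ (fP i)
      g-inj : ∀ i j → g i ~ g j → i ≡ j
      g-inj zero    zero    _ = refl
      g-inj zero    (suc j) e = ⊥-elim (¬Pa (P-resp (~-sym e) (fP j)))
      g-inj (suc i) zero    e = ⊥-elim (¬Pa (P-resp e (fP i)))
      g-inj (suc i) (suc j) e = cong suc (f-inj i j e)
      g-onto : ∀ x → a ~ x ⊎ _ → ∃ λ i → g i ~ x
      g-onto x (inj₁ a~x) = zero , a~x
      g-onto x (inj₂ Px)  = let (i , fᵢ~x) = f-onto x Px in suc i , fᵢ~x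

    HasSize-remove : ∀ {P : Pred A 0ℓ} {n a} → P a → HasSize _~_ P n →
                     HasSize _~_ (λ x → P x × ¬ x ~ a) (n ℕ.∸ 1)
    HasSize-remove {n = zero} Pa (_ , _ , _ , f-onto) with f-onto _ Pa
    ... | () , _
    HasSize-remove {n = suc n} {a} Pa (f , fP , f-inj , f-onto) = g , gP , g-inj , g-onto
      where
      i₀ = proj₁ (f-onto a Pa)
      fi₀~a = proj₂ (f-onto a Pa)
      g : Fin n → A
      g j = f (punchIn i₀ j)
      gP : ∀ j → _ × ¬ g j ~ a
      gP j = fP _ , λ e → punchInᵢ≢i i₀ j (f-inj _ _ (~-trans e (~-sym fi₀~a)))
      g-inj : ∀ i j → g i ~ g j → i ≡ j
      g-inj i j e = punchIn-injective i₀ i j (f-inj _ _ e)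
      g-onto : ∀ x → _ × ¬ x ~ a → ∃ λ j → g j ~ x
      g-onto x (Px , x≁a) with f-onto x Px
      ... | i , fi~x = punchOut i₀≢i , subst (λ l → f l ~ x) (sym (punchIn-punchOut i₀≢i)) fi~x
        where
        i₀≢i : ¬ i₀ ≡ i
        i₀≢i refl = x≁a (~-trans (~-sym fi~x) fi₀~a)

    HasSize-any? : ∀ {P : Pred A 0ℓ} {n} → HasSize _~_ (λ _ → ⊤) n → P Respects _~_ → Decidable P →
                   Dec (∃ P)
    HasSize-any? (f , _ , _ , f-onto) P-resp P? =
      map′ (λ (i , Pfᵢ) → f i , Pfᵢ)
           (λ (a , Pa) → let (i , fᵢ~a) = f-onto a tt in i , P-resp (~-sym fᵢ~a) Pa)
           (any? (P? ∘ f))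

    enumerable⇒HasSize : ∀ {P : Pred A 0ℓ} → B.Decidable _~_ → Decidable P → P Respects _~_ →
                         ∀ {N} (e : Fin N → A) → (∀ a → P a → ∃ λ i → e i ~ a) →
                         ∃ λ n → HasSize _~_ P n
    enumerable⇒HasSize {P} _≟_ P? P-resp e e-onto =
      map₂ (HasSize-cong (λ _ → proj₁) (λ a Pa → Pa , e-onto a Pa)) (image e)
      where
      Image : ∀ {N} → (Fin N → A) → Pred A 0ℓ
      Image e a = P a × ∃ λ i → e i ~ a

      Image-resp : ∀ {N} (e : Fin N → A) → Image e Respects _~_
      Image-resp e x~y (Px , i , eᵢ~x) = P-resp x~y Px , i , ~-trans eᵢ~x x~y

      drop-head : ∀ {N} (e : Fin (suc N) → A) → (P (e zero) → ∃ λ j → e (suc j) ~ e zero) →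
                  ∀ a → Image e a → Image (e ∘ suc) a
      drop-head e repeated a (Pa , zero , e₀~a) =
        let (j , eⱼ~e₀) = repeated (P-resp (~-sym e₀~a) Pa) in Pa , j , ~-trans eⱼ~e₀ e₀~a
      drop-head e repeated a (Pa , suc i , eᵢ~a) = Pa , i , eᵢ~a

      image : ∀ {N} (e : Fin N → A) → ∃ λ n → HasSize _~_ (Image e) n
      image {zero} e = 0 , HasSize-∅ λ { a (_ , () , _) }
      image {suc N} e with image (e ∘ suc) | P? (e zero) | any? (λ i → e (suc i) ≟ e zero)
      ... | n , s | yes Pe₀ | no fresh =
        suc n , HasSize-cong grow shrink
                  (HasSize-insert (Image-resp (e ∘ suc)) (λ (_ , i , eᵢ~e₀) → fresh (i , eᵢ~e₀)) s)
        where
        grow : ∀ a → e zero ~ a ⊎ Image (e ∘ suc) a → Image e a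
        grow a (inj₁ e₀~a)           = P-resp e₀~a Pe₀ , zero , e₀~a
        grow a (inj₂ (Pa , i , eᵢ~a)) = Pa , suc i , eᵢ~a
        shrink : ∀ a → Image e a → e zero ~ a ⊎ Image (e ∘ suc) a
        shrink a (Pa , zero , e₀~a)  = inj₁ e₀~a
        shrink a (Pa , suc i , eᵢ~a) = inj₂ (Pa , i , eᵢ~a)
      ... | n , s | yes _ | yes repeated =
        n , HasSize-cong (λ a (Pa , i , eᵢ~a) → Pa , suc i , eᵢ~a) (drop-head e (λ _ → repeated)) s
      ... | n , s | no ¬Pe₀ | _ =
        n , HasSize-cong (λ a (Pa , i , eᵢ~a) → Pa , suc i , eᵢ~a) (drop-head e (⊥-elim ∘ ¬Pe₀)) s

    2≤#classes : ∀ {_R_ : Rel A 0ℓ} {v n c} → HasSize _~_ (λ _ → ⊤) v →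
                 (∀ a → HasSize _~_ (a R_) n) → n < v → HasSize _R_ (λ _ → ⊤) c → 2 ≤ c
    2≤#classes {c = zero} (f , _) _ (s≤s _) (_ , _ , _ , r-onto) with r-onto (f zero) tt
    ... | () , _
    2≤#classes {c = suc zero} vs class n<v (r , _ , _ , r-onto) =
      ⊥-elim (<⇒≱ n<v (HasSize-≤ (λ a _ → inClass₀ a) vs (class (r zero))))
      where
      inClass₀ : ∀ a → _
      inClass₀ a with r-onto a tt
      ... | zero , r₀Ra = r₀Ra
    2≤#classes {c = suc (suc _)} _ _ _ _ = s≤s (s≤s z≤n)

  HasSize-map : ∀ {A B : Set} {_~_ : Rel A 0ℓ} {_≈_ : Rel B 0ℓ} → B.Transitive _≈_ →
                ∀ {P : Pred A 0ℓ} {Q : Pred B 0ℓ} {n} (f : ∀ a → P a → B) →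
                (∀ {a} p → Q (f a p)) →
                (∀ {a a′} p p′ → a ~ a′ → f a p ≈ f a′ p′) →
                (∀ {a a′} p p′ → f a p ≈ f a′ p′ → a ~ a′) →
                (∀ b → Q b → ∃ λ a → Σ (P a) λ p → f a p ≈ b) →
                HasSize _~_ P n → HasSize _≈_ Q n
  HasSize-map ≈-trans f fQ f-cong f-inj f-onto (g , gP , g-inj , g-onto) =
    (λ i → f (g i) (gP i)) , (λ i → fQ (gP i)) ,
    (λ i j e → g-inj i j (f-inj (gP i) (gP j) e)) ,
    λ b Qb → let (a , p , fa≈b) = f-onto b Qb ; (i , gᵢ~a) = g-onto a p
             in i , ≈-trans (f-cong (gP i) p gᵢ~a) fa≈b

  HasSize-× : ∀ {A B : Set} {_~_ : Rel A 0ℓ} {_≈_ : Rel B 0ℓ} {P : Pred A 0ℓ} {Q : Pred B 0ℓ} {n k} →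
              HasSize _~_ P n → HasSize _≈_ Q k →
              HasSize (λ x y → proj₁ x ~ proj₁ y × proj₂ x ≈ proj₂ y)
                      (λ x → P (proj₁ x) × Q (proj₂ x)) (n ℕ.* k)
  HasSize-× {_~_ = _~_} {_≈_} {n = n} {k} (f , fP , f-inj , f-onto) (g , gQ , g-inj , g-onto) =
    h , (λ c → fP _ , gQ _) , h-inj , h-onto
    where
    h : Fin (n ℕ.* k) → _
    h c = f (proj₁ (remQuot {n} k c)) , g (proj₂ (remQuot {n} k c))
    h-inj : ∀ c d → _ → c ≡ d
    h-inj c d (e₁ , e₂) = begin
      c                                    ≡⟨ combine-remQuot {n} k c ⟨
      uncurry combine (remQuot {n} k c)    ≡⟨ cong₂ combine (f-inj _ _ e₁) (g-inj _ _ e₂) ⟩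
      uncurry combine (remQuot {n} k d)    ≡⟨ combine-remQuot {n} k d ⟩
      d                                    ∎
      where open ≡-Reasoning
    h-onto : ∀ x → _ → ∃ λ c → _
    h-onto (a , b) (Pa , Qb) with f-onto a Pa | g-onto b Qb
    ... | i , fᵢ~a | j , gⱼ≈b = combine i j ,
      subst (λ (i′ , j′) → f i′ ~ a × g j′ ≈ b) (sym (remQuot-combine {n} i j)) (fᵢ~a , gⱼ≈b)

module Vectors {q : ℕ} (F : FiniteField q) where
  open Counting
  open import Data.Nat using (ℕ; zero; suc; _^_)
  open import Data.Fin using (Fin)
  open import Data.Fin.Properties using (nonZeroIndex)
  open import Data.Product using (_×_; _,_)
  open import Data.Unit using (⊤; tt)
  open import Data.Vec using (Vec; []; _∷_; zipWith)
  open import Data.Vec.Relation.Binary.Pointwise.Inductive as Pointwise using ([]; _∷_)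
  open import Function.Bundles using (Inverse)
  open import Relation.Binary using (IsEquivalence)
  open import Relation.Binary.PropositionalEquality as ≡ using (_≡_)
  open import Relation.Nullary using (Dec)

  open FiniteField F
  open import Algebra.Properties.Ring ring using (-1*x≈-x; x[y-z]≈xy-xz; [y-z]x≈yx-zx)
  open import Algebra.Properties.AbelianGroup +-abelianGroup using (⁻¹-anti-homo‿-; ⁻¹-∙-comm)
  open import Algebra.Properties.Group +-group using (ε⁻¹≈ε)
  open import Algebra.Properties.CommutativeSemigroup +-commutativeSemigroup using (interchange)

  instance
    q-nonZero : ℕ.NonZero q
    q-nonZero = nonZeroIndex (Inverse.from enum 0#)

  carrier-size : HasSize _≈_ (λ _ → ⊤) q
  carrier-size = to , (λ _ → tt) , to-injective , λ c _ → from c , strictlyInverseˡ c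
    where
    open Inverse enum
    to-injective : ∀ i j → to i ≈ to j → i ≡ j
    to-injective i j e = ≡.trans (≡.sym (strictlyInverseʳ i)) (≡.trans (from-cong e) (strictlyInverseʳ j))

  module _ {n : ℕ} where
    open PG F n public using (𝟎)
      renaming (_≋_ to infix 4 _≋_; _⊕_ to infixl 6 _⊕_; _⊙_ to infixr 7 _⊙_)

    infixl 6 _⊖_
    _⊖_ : Vec Carrier n → Vec Carrier n → Vec Carrier n
    _⊖_ = zipWith _-_

  ≋-isEquivalence : ∀ {n} → IsEquivalence (_≋_ {n})
  ≋-isEquivalence = Pointwise.isEquivalence isEquivalence _

  module _ {n : ℕ} where
    open IsEquivalence (≋-isEquivalence {n}) public
      using () renaming (refl to ≋-refl; sym to ≋-sym; trans to ≋-trans)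

  _≋?_ : ∀ {n} (u v : Vec Carrier n) → Dec (u ≋ v)
  _≋?_ = Pointwise.decidable _≟_

  vectors-size : ∀ n → HasSize (_≋_ {n}) (λ _ → ⊤) (q ^ n)
  vectors-size zero =
    (λ _ → []) , (λ _ → tt) , (λ { Fin.zero Fin.zero _ → ≡.refl }) , λ { [] _ → Fin.zero , [] }
  vectors-size (suc n) = HasSize-map {_~_ = λ (c , u) (d , v) → c ≈ d × u ≋ v} {_≈_ = _≋_} ≋-trans
    (λ (c , v) _ → c ∷ v) (λ _ → tt)
    (λ _ _ (c≈c′ , v≋v′) → c≈c′ ∷ v≋v′) (λ { _ _ (c≈c′ ∷ v≋v′) → c≈c′ , v≋v′ })
    (λ { (c ∷ v) _ → (c , v) , (tt , tt) , ≋-refl })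
    (HasSize-× {_~_ = _≈_} {_≈_ = _≋_} carrier-size (vectors-size n))

  ⊕-cong : ∀ {n} {u u′ v v′ : Vec Carrier n} → u ≋ u′ → v ≋ v′ → u ⊕ v ≋ u′ ⊕ v′
  ⊕-cong [] [] = []
  ⊕-cong (x≈x′ ∷ u≋u′) (y≈y′ ∷ v≋v′) = +-cong x≈x′ y≈y′ ∷ ⊕-cong u≋u′ v≋v′

  ⊙-cong : ∀ {n c d} {u v : Vec Carrier n} → c ≈ d → u ≋ v → c ⊙ u ≋ d ⊙ v
  ⊙-cong c≈d [] = []
  ⊙-cong c≈d (x≈y ∷ u≋v) = *-cong c≈d x≈y ∷ ⊙-cong c≈d u≋v

  ⊖-cong : ∀ {n} {u u′ v v′ : Vec Carrier n} → u ≋ u′ → v ≋ v′ → u ⊖ v ≋ u′ ⊖ v′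
  ⊖-cong [] [] = []
  ⊖-cong (x≈x′ ∷ u≋u′) (y≈y′ ∷ v≋v′) = +-cong x≈x′ (-‿cong y≈y′) ∷ ⊖-cong u≋u′ v≋v′

  ⊕-comm : ∀ {n} (u v : Vec Carrier n) → u ⊕ v ≋ v ⊕ u
  ⊕-comm [] [] = []
  ⊕-comm (x ∷ u) (y ∷ v) = +-comm x y ∷ ⊕-comm u v

  ⊕-identityʳ : ∀ {n} (u : Vec Carrier n) → u ⊕ 𝟎 ≋ u
  ⊕-identityʳ [] = []
  ⊕-identityʳ (x ∷ u) = +-identityʳ x ∷ ⊕-identityʳ u

  ⊕-identityˡ : ∀ {n} (u : Vec Carrier n) → 𝟎 ⊕ u ≋ u
  ⊕-identityˡ u = ≋-trans (⊕-comm 𝟎 u) (⊕-identityʳ u)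

  ⊙-assoc : ∀ {n} c d (u : Vec Carrier n) → c ⊙ (d ⊙ u) ≋ (c * d) ⊙ u
  ⊙-assoc c d [] = []
  ⊙-assoc c d (x ∷ u) = sym (*-assoc c d x) ∷ ⊙-assoc c d u

  ⊙-identityˡ : ∀ {n} (u : Vec Carrier n) → 1# ⊙ u ≋ u
  ⊙-identityˡ [] = []
  ⊙-identityˡ (x ∷ u) = *-identityˡ x ∷ ⊙-identityˡ u

  ⊙-zeroˡ : ∀ {n} (u : Vec Carrier n) → 0# ⊙ u ≋ 𝟎
  ⊙-zeroˡ [] = []
  ⊙-zeroˡ (x ∷ u) = zeroˡ x ∷ ⊙-zeroˡ u

  ⊙-zeroʳ : ∀ {n} c → c ⊙ 𝟎 {n} ≋ 𝟎
  ⊙-zeroʳ {zero} c = []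
  ⊙-zeroʳ {suc n} c = zeroʳ c ∷ ⊙-zeroʳ c

  ⊙-distribʳ : ∀ {n} c d (u : Vec Carrier n) → (c + d) ⊙ u ≋ c ⊙ u ⊕ d ⊙ u
  ⊙-distribʳ c d [] = []
  ⊙-distribʳ c d (x ∷ u) = distribʳ x c d ∷ ⊙-distribʳ c d u

  ⊙-distribˡ-⊖ : ∀ {n} c (u v : Vec Carrier n) → c ⊙ (u ⊖ v) ≋ c ⊙ u ⊖ c ⊙ v
  ⊙-distribˡ-⊖ c [] [] = []
  ⊙-distribˡ-⊖ c (x ∷ u) (y ∷ v) = x[y-z]≈xy-xz c x y ∷ ⊙-distribˡ-⊖ c u v

  ⊙-distribʳ-⊖ : ∀ {n} c d (u : Vec Carrier n) → (c - d) ⊙ u ≋ c ⊙ u ⊖ d ⊙ u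
  ⊙-distribʳ-⊖ c d [] = []
  ⊙-distribʳ-⊖ c d (x ∷ u) = [y-z]x≈yx-zx x c d ∷ ⊙-distribʳ-⊖ c d u

  ⊖≋⊕-1⊙ : ∀ {n} (u v : Vec Carrier n) → u ⊖ v ≋ u ⊕ (- 1#) ⊙ v
  ⊖≋⊕-1⊙ [] [] = []
  ⊖≋⊕-1⊙ (x ∷ u) (y ∷ v) = +-congˡ (sym (-1*x≈-x y)) ∷ ⊖≋⊕-1⊙ u v

  ⊖-self : ∀ {n} (u : Vec Carrier n) → u ⊖ u ≋ 𝟎
  ⊖-self [] = []
  ⊖-self (x ∷ u) = -‿inverseʳ x ∷ ⊖-self u

  ⊖-identityʳ : ∀ {n} (u : Vec Carrier n) → u ⊖ 𝟎 ≋ u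
  ⊖-identityʳ [] = []
  ⊖-identityʳ (x ∷ u) = trans (+-congˡ ε⁻¹≈ε) (+-identityʳ x) ∷ ⊖-identityʳ u

  ⊖-anticomm : ∀ {n} (u v : Vec Carrier n) → v ⊖ u ≋ (- 1#) ⊙ (u ⊖ v)
  ⊖-anticomm [] [] = []
  ⊖-anticomm (x ∷ u) (y ∷ v) = sym (trans (-1*x≈-x (x - y)) (⁻¹-anti-homo‿- x y)) ∷ ⊖-anticomm u v

  [x-y]+y≈x : ∀ x y → (x - y) + y ≈ x
  [x-y]+y≈x x y = trans (+-assoc x (- y) y) (trans (+-congˡ (-‿inverseˡ y)) (+-identityʳ x))

  ⊖-⊕-cancel : ∀ {n} (u v : Vec Carrier n) → (u ⊖ v) ⊕ v ≋ u
  ⊖-⊕-cancel [] [] = []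
  ⊖-⊕-cancel (x ∷ u) (y ∷ v) = [x-y]+y≈x x y ∷ ⊖-⊕-cancel u v

  ⊕-⊖-cancel : ∀ {n} (u v : Vec Carrier n) → (u ⊕ v) ⊖ v ≋ u
  ⊕-⊖-cancel [] [] = []
  ⊕-⊖-cancel (x ∷ u) (y ∷ v) =
    trans (+-assoc x y (- y)) (trans (+-congˡ (-‿inverseʳ y)) (+-identityʳ x)) ∷ ⊕-⊖-cancel u v

  ⊖-split : ∀ {n} (u v w : Vec Carrier n) → u ⊖ w ≋ (u ⊖ v) ⊕ (v ⊖ w)
  ⊖-split [] [] [] = []
  ⊖-split (x ∷ u) (y ∷ v) (z ∷ w) =
    sym (trans (sym (+-assoc (x - y) y (- z))) (+-congʳ ([x-y]+y≈x x y))) ∷ ⊖-split u v w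

  ⊕-⊖-interchange : ∀ {n} (u u′ v v′ : Vec Carrier n) →
                    (u ⊕ u′) ⊖ (v ⊕ v′) ≋ (u ⊖ v) ⊕ (u′ ⊖ v′)
  ⊕-⊖-interchange [] [] [] [] = []
  ⊕-⊖-interchange (x ∷ u) (x′ ∷ u′) (y ∷ v) (y′ ∷ v′) =
    trans (+-congˡ (sym (⁻¹-∙-comm y y′))) (interchange x x′ (- y) (- y′))
    ∷ ⊕-⊖-interchange u u′ v v′

  ⊙-inverse : ∀ {n} {c c′} (u : Vec Carrier n) → c * c′ ≈ 1# → c′ ⊙ (c ⊙ u) ≋ u
  ⊙-inverse {c = c} {c′} u cc′≈1 = ≋-trans (⊙-assoc c′ c u)
    (≋-trans (⊙-cong (trans (*-comm c′ c) cc′≈1) ≋-refl) (⊙-identityˡ u))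

  ⊕-cancelʳ : ∀ {n} {u v : Vec Carrier n} w → u ⊕ w ≋ v ⊕ w → u ≋ v
  ⊕-cancelʳ {u = u} {v} w e =
    ≋-trans (≋-sym (⊕-⊖-cancel u w)) (≋-trans (⊖-cong e ≋-refl) (⊕-⊖-cancel v w))

module Subspaces {q : ℕ} (F : FiniteField q) (m : ℕ) where
  open Counting
  open import Data.Nat using (ℕ; _^_)
  open import Data.Bool as Bool using (true)
  open import Data.Product using (∃; _×_; _,_; proj₁; proj₂)
  open import Data.Sum using (_⊎_; inj₁; inj₂)
  open import Data.Unit using (⊤; tt)
  open import Data.Empty using (⊥-elim)
  open import Function.Bundles using (_⇔_; mk⇔; Equivalence)
  open import Relation.Binary using (_Respects_)
  open import Relation.Binary.PropositionalEquality as ≡ using (_≡_)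
  open import Relation.Nullary using (¬_; ¬?; Dec; yes; no; does; _×-dec_)
  open import Relation.Nullary.Decidable using (decidable-stable; dec-true; does-⇔)
  open import Function using (_∘_)
  import Data.Fin as Fin

  does⇒ : ∀ {A : Set} (A? : Dec A) → does A? ≡ true → A
  does⇒ (yes a) _  = a
  does⇒ (no _)  ()

  open FiniteField F
  open Vectors F
  open import Algebra.Properties.Group +-group using (x∙y⁻¹≈ε⇒x≈y)
  open PG F m public using (Vector; Subspace; mem; resp; 𝟎∈; ⊕∈; ⊙∈; IsPoint; InJoin)
    renaming (_∈_ to infix 4 _∈_; _⊆_ to infix 4 _⊆_; _≐_ to infix 4 _≐_)

  ∈-resp-≋ : ∀ S {u v} → u ≋ v → u ∈ S → v ∈ S
  ∈-resp-≋ S u≋v u∈S = ≡.trans (≡.sym (resp S u≋v)) u∈S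

  _∈?_ : ∀ v S → Dec (v ∈ S)
  v ∈? S = mem S v Bool.≟ true

  ⊖∈ : ∀ S {u v} → u ∈ S → v ∈ S → u ⊖ v ∈ S
  ⊖∈ S u∈S v∈S = ∈-resp-≋ S (≋-sym (⊖≋⊕-1⊙ _ _)) (⊕∈ S u∈S (⊙∈ S (- 1#) v∈S))

  ⊆-trans : ∀ {S T U} → S ⊆ T → T ⊆ U → S ⊆ U
  ⊆-trans S⊆T T⊆U v v∈S = T⊆U v (S⊆T v v∈S)

  subspace : (P : Vector → Set) → (∀ v → Dec (P v)) → P Respects _≋_ → P 𝟎 →
             (∀ {u v} → P u → P v → P (u ⊕ v)) → (∀ c {u} → P u → P (c ⊙ u)) → Subspace
  subspace P P? P-resp P𝟎 P-⊕ P-⊙ = record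
    { mem  = λ v → does (P? v)
    ; resp = λ u≋v → does-⇔ (mk⇔ (P-resp u≋v) (P-resp (≋-sym u≋v))) (P? _) (P? _)
    ; 𝟎∈   = dec-true (P? 𝟎) P𝟎
    ; ⊕∈   = λ u∈ v∈ → dec-true (P? _) (P-⊕ (does⇒ (P? _) u∈) (does⇒ (P? _) v∈))
    ; ⊙∈   = λ c u∈ → dec-true (P? _) (P-⊙ c (does⇒ (P? _) u∈))
    }

  -- The subspaces and the congruence built below are opaque and used only through their
  -- introduction/elimination lemmas: unfolded, `v ∈ S` becomes a decision procedure from
  -- which Agda cannot recover S.
  opaque
    trivial : Subspace
    trivial = subspace (_≋ 𝟎) (_≋? 𝟎) (λ u≋v u≋𝟎 → ≋-trans (≋-sym u≋v) u≋𝟎) ≋-refl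
      (λ u≋𝟎 v≋𝟎 → ≋-trans (⊕-cong u≋𝟎 v≋𝟎) (⊕-identityʳ 𝟎))
      (λ c u≋𝟎 → ≋-trans (⊙-cong refl u≋𝟎) (⊙-zeroʳ c))

    ∈-trivial⁺ : ∀ {v} → v ≋ 𝟎 → v ∈ trivial
    ∈-trivial⁺ {v} = dec-true (v ≋? 𝟎)

    ∈-trivial⁻ : ∀ {v} → v ∈ trivial → v ≋ 𝟎
    ∈-trivial⁻ {v} = does⇒ (v ≋? 𝟎)

  trivial⊆ : ∀ S → trivial ⊆ S
  trivial⊆ S v v∈ = ∈-resp-≋ S (≋-sym (∈-trivial⁻ v∈)) (𝟎∈ S)

  whole : Subspace
  whole = record
    { mem = λ _ → true ; resp = λ _ → ≡.refl ; 𝟎∈ = ≡.refl ; ⊕∈ = λ _ _ → ≡.refl ; ⊙∈ = λ _ _ → ≡.refl }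

  opaque
    infixl 7 _∩_
    _∩_ : Subspace → Subspace → Subspace
    S ∩ T = subspace (λ v → v ∈ S × v ∈ T) (λ v → (v ∈? S) ×-dec (v ∈? T))
      (λ u≋v (u∈S , u∈T) → ∈-resp-≋ S u≋v u∈S , ∈-resp-≋ T u≋v u∈T) (𝟎∈ S , 𝟎∈ T)
      (λ (u∈S , u∈T) (v∈S , v∈T) → ⊕∈ S u∈S v∈S , ⊕∈ T u∈T v∈T)
      (λ c (u∈S , u∈T) → ⊙∈ S c u∈S , ⊙∈ T c u∈T)

    ∈-∩⁺ : ∀ {S T v} → v ∈ S → v ∈ T → v ∈ S ∩ T
    ∈-∩⁺ {S} {T} {v} v∈S v∈T = dec-true ((v ∈? S) ×-dec (v ∈? T)) (v∈S , v∈T)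

    ∈-∩⁻ : ∀ {S T v} → v ∈ S ∩ T → v ∈ S × v ∈ T
    ∈-∩⁻ {S} {T} {v} = does⇒ ((v ∈? S) ×-dec (v ∈? T))

  ∩-comm : ∀ S T → S ∩ T ⊆ T ∩ S
  ∩-comm S T v v∈ = let (v∈S , v∈T) = ∈-∩⁻ {S} {T} v∈ in ∈-∩⁺ {T} {S} v∈T v∈S

  ⊙∈⇒≈0 : ∀ {S b} c → ¬ b ∈ S → c ⊙ b ∈ S → c ≈ 0#
  ⊙∈⇒≈0 {S} {b} c b∉S cb∈S with c ≟ 0#
  ... | yes c≈0 = c≈0
  ... | no c≉0 = let (c′ , cc′≈1) = inverse c c≉0 in
    ⊥-elim (b∉S (∈-resp-≋ S (⊙-inverse b cc′≈1) (⊙∈ S c′ cb∈S)))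

  opaque
    infix 4 _≡_mod_
    _≡_mod_ : Vector → Vector → Subspace → Set
    _≡_mod_ u v S = u ⊖ v ∈ S

    ≡-mod⇒⊖∈ : ∀ {S u v} → u ≡ v mod S → u ⊖ v ∈ S
    ≡-mod⇒⊖∈ u≡v = u≡v

    ⊖∈⇒≡-mod : ∀ {S u v} → u ⊖ v ∈ S → u ≡ v mod S
    ⊖∈⇒≡-mod u⊖v∈S = u⊖v∈S

    _≡?_mod_ : ∀ u v S → Dec (u ≡ v mod S)
    u ≡? v mod S = (u ⊖ v) ∈? S

  module _ {S : Subspace} where

    ≋⇒≡-mod : ∀ {u v} → u ≋ v → u ≡ v mod S
    ≋⇒≡-mod {u} u≋v =
      ⊖∈⇒≡-mod (∈-resp-≋ S (≋-sym (≋-trans (⊖-cong ≋-refl (≋-sym u≋v)) (⊖-self u))) (𝟎∈ S))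

    mod-sym : ∀ {u v} → u ≡ v mod S → v ≡ u mod S
    mod-sym {u} {v} u≡v =
      ⊖∈⇒≡-mod (∈-resp-≋ S (≋-sym (⊖-anticomm u v)) (⊙∈ S (- 1#) (≡-mod⇒⊖∈ u≡v)))

    mod-trans : ∀ {u v w} → u ≡ v mod S → v ≡ w mod S → u ≡ w mod S
    mod-trans {u} {v} {w} u≡v v≡w =
      ⊖∈⇒≡-mod (∈-resp-≋ S (≋-sym (⊖-split u v w)) (⊕∈ S (≡-mod⇒⊖∈ u≡v) (≡-mod⇒⊖∈ v≡w)))

    mod-⊕ : ∀ {u u′ v v′} → u ≡ v mod S → u′ ≡ v′ mod S → u ⊕ u′ ≡ v ⊕ v′ mod S
    mod-⊕ {u} {u′} {v} {v′} u≡v u′≡v′ =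
      ⊖∈⇒≡-mod (∈-resp-≋ S (≋-sym (⊕-⊖-interchange u u′ v v′))
                             (⊕∈ S (≡-mod⇒⊖∈ u≡v) (≡-mod⇒⊖∈ u′≡v′)))

    mod-⊙ : ∀ c {u v} → u ≡ v mod S → c ⊙ u ≡ c ⊙ v mod S
    mod-⊙ c {u} {v} u≡v =
      ⊖∈⇒≡-mod (∈-resp-≋ S (⊙-distribˡ-⊖ c u v) (⊙∈ S c (≡-mod⇒⊖∈ u≡v)))

    ∈⇒≡𝟎 : ∀ {v} → v ∈ S → v ≡ 𝟎 mod S
    ∈⇒≡𝟎 {v} v∈S = ⊖∈⇒≡-mod (∈-resp-≋ S (≋-sym (⊖-identityʳ v)) v∈S)

    ∈-resp-≡-mod : ∀ {u v} → u ≡ v mod S → v ∈ S → u ∈ S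
    ∈-resp-≡-mod {u} u≡v v∈S =
      ∈-resp-≋ S (⊖-identityʳ u) (≡-mod⇒⊖∈ (mod-trans u≡v (∈⇒≡𝟎 v∈S)))

    ⊙-cancel-mod : ∀ {b c d} → ¬ b ∈ S → c ⊙ b ≡ d ⊙ b mod S → c ≈ d
    ⊙-cancel-mod {b} {c} {d} b∉S cb≡db =
      x∙y⁻¹≈ε⇒x≈y c d
        (⊙∈⇒≈0 {S} (c - d) b∉S (∈-resp-≋ S (≋-sym (⊙-distribʳ-⊖ c d b)) (≡-mod⇒⊖∈ cb≡db)))

  ≡-mod-mono : ∀ {S T u v} → S ⊆ T → u ≡ v mod S → u ≡ v mod T
  ≡-mod-mono S⊆T u≡v = ⊖∈⇒≡-mod (S⊆T _ (≡-mod⇒⊖∈ u≡v))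

  ∈⇒⊕≡-mod : ∀ {S s v} → s ∈ S → s ⊕ v ≡ v mod S
  ∈⇒⊕≡-mod {S} {s} {v} s∈S = ⊖∈⇒≡-mod (∈-resp-≋ S (≋-sym (⊕-⊖-cancel s v)) s∈S)

  ≡-mod-trivial⇒≋ : ∀ {u v} → u ≡ v mod trivial → u ≋ v
  ≡-mod-trivial⇒≋ {u} {v} u≡v = ≋-trans (≋-sym (⊖-⊕-cancel u v))
    (≋-trans (⊕-cong (∈-trivial⁻ (≡-mod⇒⊖∈ u≡v)) ≋-refl) (⊕-identityˡ v))

  multiple? : ∀ S u w → Dec (∃ λ c → w ≡ c ⊙ u mod S)
  multiple? S u w = HasSize-any? isEquivalence carrier-size
    (λ c≈d w≡cu → mod-trans w≡cu (≋⇒≡-mod (⊙-cong c≈d ≋-refl))) (λ c → w ≡? c ⊙ u mod S)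

  opaque
    infixl 6 _+⟨_⟩
    _+⟨_⟩ : Subspace → Vector → Subspace
    S +⟨ u ⟩ = subspace (λ w → ∃ λ c → w ≡ c ⊙ u mod S) (multiple? S u)
      (λ w≋w′ (c , w≡cu) → c , mod-trans (≋⇒≡-mod (≋-sym w≋w′)) w≡cu)
      (0# , ≋⇒≡-mod (≋-sym (⊙-zeroˡ u)))
      (λ (c , w≡cu) (d , w′≡du) →
         c + d , mod-trans (mod-⊕ w≡cu w′≡du) (≋⇒≡-mod (≋-sym (⊙-distribʳ c d u))))
      (λ c (d , w≡du) → c * d , mod-trans (mod-⊙ c w≡du) (≋⇒≡-mod (⊙-assoc c d u)))

    ∈-+⟨⟩⁺ : ∀ {S u w} c → w ≡ c ⊙ u mod S → w ∈ S +⟨ u ⟩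
    ∈-+⟨⟩⁺ {S} {u} {w} c w≡cu = dec-true (multiple? S u w) (c , w≡cu)

    ∈-+⟨⟩⁻ : ∀ {S u w} → w ∈ S +⟨ u ⟩ → ∃ λ c → w ≡ c ⊙ u mod S
    ∈-+⟨⟩⁻ {S} {u} {w} = does⇒ (multiple? S u w)

  module _ {S : Subspace} {u : Vector} where

    u∈+⟨u⟩ : u ∈ S +⟨ u ⟩
    u∈+⟨u⟩ = ∈-+⟨⟩⁺ 1# (≋⇒≡-mod (≋-sym (⊙-identityˡ u)))

    ⊆+⟨⟩ : S ⊆ S +⟨ u ⟩
    ⊆+⟨⟩ w w∈S = ∈-+⟨⟩⁺ 0# (mod-trans (∈⇒≡𝟎 w∈S) (≋⇒≡-mod (≋-sym (⊙-zeroˡ u))))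

    +⟨⟩-least : ∀ {T} → S ⊆ T → u ∈ T → S +⟨ u ⟩ ⊆ T
    +⟨⟩-least {T} S⊆T u∈T w w∈ = let (c , w≡cu) = ∈-+⟨⟩⁻ w∈ in
      ∈-resp-≡-mod {T} (≡-mod-mono S⊆T w≡cu) (⊙∈ T c u∈T)

  +⟨⟩-exchange : ∀ {S u v} → v ∈ S +⟨ u ⟩ → ¬ v ∈ S → u ∈ S +⟨ v ⟩
  +⟨⟩-exchange {S} {u} {v} v∈ v∉S with ∈-+⟨⟩⁻ v∈
  ... | c , v≡cu with c ≟ 0#
  ...   | yes c≈0 = ⊥-elim (v∉S (∈-resp-≡-mod v≡cu
                        (∈-resp-≋ S (≋-sym (≋-trans (⊙-cong c≈0 ≋-refl) (⊙-zeroˡ u))) (𝟎∈ S))))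
  ...   | no c≉0 = let (c′ , cc′≈1) = inverse c c≉0 in
    ∈-+⟨⟩⁺ c′ (mod-sym (mod-trans (mod-⊙ c′ v≡cu) (≋⇒≡-mod (⊙-inverse u cc′≈1))))

  ⟨_⟩ : Vector → Subspace
  ⟨ u ⟩ = trivial +⟨ u ⟩

  ∈⟨⟩⇔ : ∀ {u w} → w ∈ ⟨ u ⟩ ⇔ (∃ λ c → w ≋ c ⊙ u)
  ∈⟨⟩⇔ = mk⇔ (λ w∈ → let (c , w≡cu) = ∈-+⟨⟩⁻ w∈ in c , ≡-mod-trivial⇒≋ w≡cu)
              (λ (c , w≋cu) → ∈-+⟨⟩⁺ c (≋⇒≡-mod w≋cu))

  ⟨⟩-least : ∀ {u} T → u ∈ T → ⟨ u ⟩ ⊆ T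
  ⟨⟩-least {u} T = +⟨⟩-least {trivial} {u} {T} (trivial⊆ T)

  ⟨⟩-cong : ∀ {u v} → u ≋ v → ⟨ u ⟩ ≐ ⟨ v ⟩
  ⟨⟩-cong {u} {v} u≋v = ⟨⟩-least ⟨ v ⟩ (∈-resp-≋ ⟨ v ⟩ (≋-sym u≋v) u∈+⟨u⟩) ,
                        ⟨⟩-least ⟨ u ⟩ (∈-resp-≋ ⟨ u ⟩ u≋v u∈+⟨u⟩)

  ⟨⟩-IsPoint : ∀ {u} → ¬ u ≋ 𝟎 → IsPoint ⟨ u ⟩
  ⟨⟩-IsPoint {u} u≉𝟎 = u , u≉𝟎 , λ _ → ∈⟨⟩⇔

  module Point {S : Subspace} (S-point : IsPoint S) where

    generator : Vector
    generator = proj₁ S-point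

    generator≉𝟎 : ¬ generator ≋ 𝟎
    generator≉𝟎 = proj₁ (proj₂ S-point)

    ∈⇔multiple : ∀ w → w ∈ S ⇔ (∃ λ c → w ≋ c ⊙ generator)
    ∈⇔multiple = proj₂ (proj₂ S-point)

    generator∈ : generator ∈ S
    generator∈ = Equivalence.from (∈⇔multiple _) (1# , ≋-sym (⊙-identityˡ generator))

    generator∈⇒⊆ : ∀ {T} → generator ∈ T → S ⊆ T
    generator∈⇒⊆ {T} g∈T w w∈S = let (c , w≋cg) = Equivalence.to (∈⇔multiple w) w∈S in
      ∈-resp-≋ T (≋-sym w≋cg) (⊙∈ T c g∈T)

    nonzero∈⇒⊆ : ∀ {T w} → w ∈ S → ¬ w ≋ 𝟎 → w ∈ T → S ⊆ T
    nonzero∈⇒⊆ {T} {w} w∈S w≉𝟎 w∈T with Equivalence.to (∈⇔multiple w) w∈S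
    ... | c , w≋cg with c ≟ 0#
    ...   | yes c≈0 = ⊥-elim (w≉𝟎 (≋-trans w≋cg (≋-trans (⊙-cong c≈0 ≋-refl) (⊙-zeroˡ generator))))
    ...   | no c≉0 = let (c′ , cc′≈1) = inverse c c≉0 in generator∈⇒⊆ {T}
      (∈-resp-≋ T (≋-trans (⊙-cong refl w≋cg) (⊙-inverse generator cc′≈1)) (⊙∈ T c′ w∈T))

    ⊆-dichotomy : ∀ {T} → T ⊆ S → S ⊆ T ⊎ T ⊆ trivial
    ⊆-dichotomy {T} T⊆S with generator ∈? T
    ... | yes g∈T = inj₁ (generator∈⇒⊆ {T} g∈T)
    ... | no g∉T = inj₂ λ w w∈T → ∈-trivial⁺ (≋𝟎 w w∈T)
      where
      ≋𝟎 : ∀ w → w ∈ T → w ≋ 𝟎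
      ≋𝟎 w w∈T with w ≋? 𝟎
      ... | yes w≋𝟎 = w≋𝟎
      ... | no w≉𝟎 =
        ⊥-elim (g∉T (nonzero∈⇒⊆ {T} (T⊆S w w∈T) w≉𝟎 w∈T generator generator∈))

  points-⊆⇒≐ : ∀ {S T} → IsPoint S → IsPoint T → S ⊆ T → S ≐ T
  points-⊆⇒≐ {S} {T} S-point T-point S⊆T = S⊆T ,
    Point.nonzero∈⇒⊆ {T} T-point {S} (S⊆T _ g∈S) (Point.generator≉𝟎 {S} S-point) g∈S
    where g∈S = Point.generator∈ {S} S-point

  InJoin⇔+⟨⟩ : ∀ {S T} (T-point : IsPoint T) w →
               InJoin S T w ⇔ w ∈ S +⟨ Point.generator {T} T-point ⟩
  InJoin⇔+⟨⟩ {S} {T} T-point w = mk⇔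
    (λ (s , t , s∈S , t∈T , w≋s⊕t) → let (c , t≋cg) = Equivalence.to (∈⇔multiple t) t∈T in
      ∈-+⟨⟩⁺ c (mod-trans (≋⇒≡-mod w≋s⊕t)
                 (mod-trans (∈⇒⊕≡-mod {S} s∈S) (≋⇒≡-mod t≋cg))))
    (λ w∈ → let (c , w≡cg) = ∈-+⟨⟩⁻ w∈ in
      w ⊖ c ⊙ generator , c ⊙ generator , ≡-mod⇒⊖∈ w≡cg ,
      Equivalence.from (∈⇔multiple _) (c , ≋-refl) , ≋-sym (⊖-⊕-cancel w (c ⊙ generator)))
    where open Point {T} T-point

  InJoin-comm : ∀ {S T w} → InJoin S T w → InJoin T S w
  InJoin-comm {w = w} (s , t , s∈S , t∈T , w≋s⊕t) = t , s , t∈T , s∈S , ≋-trans w≋s⊕t (⊕-comm s t)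

  any?-Vector : ∀ {P : Vector → Set} → P Respects _≋_ → (∀ v → Dec (P v)) → Dec (∃ P)
  any?-Vector = HasSize-any? ≋-isEquivalence (vectors-size m)

  ⊈⇒∃∉ : ∀ {S T} → ¬ S ⊆ T → ∃ λ v → v ∈ S × ¬ v ∈ T
  ⊈⇒∃∉ {S} {T} S⊈T
    with any?-Vector (λ u≋v (u∈S , u∉T) → ∈-resp-≋ S u≋v u∈S , u∉T ∘ ∈-resp-≋ T (≋-sym u≋v))
                     (λ v → (v ∈? S) ×-dec ¬? (v ∈? T))
  ... | yes witness = witness
  ... | no none = ⊥-elim (S⊈T λ v v∈S → decidable-stable (v ∈? T) λ v∉T → none (v , v∈S , v∉T))

  sizeOf : ∀ S → ∃ λ k → HasSize _≋_ (_∈ S) k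
  sizeOf S = let (f , _ , _ , f-onto) = vectors-size m in
    enumerable⇒HasSize ≋-isEquivalence _≋?_ (_∈? S) (∈-resp-≋ S) f (λ v _ → f-onto v tt)

  HasSize-trivial : HasSize _≋_ (_∈ trivial) 1
  HasSize-trivial = (λ _ → 𝟎) , (λ _ → ∈-trivial⁺ ≋-refl) , (λ { Fin.zero Fin.zero _ → ≡.refl }) ,
                    λ v v∈ → Fin.zero , ≋-sym (∈-trivial⁻ v∈)

  HasSize-whole : HasSize _≋_ (_∈ whole) (q ^ m)
  HasSize-whole = HasSize-cong ≋-isEquivalence (λ _ _ → ≡.refl) (λ _ _ → tt) (vectors-size m)

  HasSize-+⟨⟩ : ∀ {S b k} → ¬ b ∈ S → HasSize _≋_ (_∈ S) k →
                HasSize _≋_ (_∈ S +⟨ b ⟩) (k ℕ.* q)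
  HasSize-+⟨⟩ {S} {b} b∉S sizeS =
    HasSize-map {_~_ = λ (s , c) (s′ , c′) → s ≋ s′ × c ≈ c′} {_≈_ = _≋_} ≋-trans
    (λ (s , c) _ → s ⊕ c ⊙ b)
    (λ {(s , c)} (s∈S , _) → ∈-+⟨⟩⁺ c (∈⇒⊕≡-mod {S} s∈S))
    (λ _ _ (s≋s′ , c≈c′) → ⊕-cong s≋s′ (⊙-cong c≈c′ ≋-refl))
    injective
    (λ w w∈ → let (c , w≡cb) = ∈-+⟨⟩⁻ w∈ in
      (w ⊖ c ⊙ b , c) , (≡-mod⇒⊖∈ w≡cb , tt) , ⊖-⊕-cancel w (c ⊙ b))
    (HasSize-× {_~_ = _≋_} {_≈_ = _≈_} sizeS carrier-size)
    where
    injective : ∀ {x y : Vector × Carrier} → proj₁ x ∈ S × ⊤ → proj₁ y ∈ S × ⊤ →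
                proj₁ x ⊕ proj₂ x ⊙ b ≋ proj₁ y ⊕ proj₂ y ⊙ b →
                proj₁ x ≋ proj₁ y × proj₂ x ≈ proj₂ y
    injective {s , c} {s′ , c′} (s∈S , _) (s′∈S , _) e = s≋s′ , c≈c′
      where
      c≈c′ : c ≈ c′
      c≈c′ = ⊙-cancel-mod b∉S
        (mod-trans (mod-sym (∈⇒⊕≡-mod {S} s∈S)) (mod-trans (≋⇒≡-mod e) (∈⇒⊕≡-mod {S} s′∈S)))
      s≋s′ : s ≋ s′
      s≋s′ = ⊕-cancelʳ (c′ ⊙ b) (≋-trans (⊕-cong ≋-refl (⊙-cong (sym c≈c′) ≋-refl)) e)

  join-comm : ∀ {S T v} (S-point : IsPoint S) (T-point : IsPoint T) →
              v ∈ S +⟨ Point.generator {T} T-point ⟩ → v ∈ T +⟨ Point.generator {S} S-point ⟩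
  join-comm {S} {T} {v} S-point T-point v∈ =
    Equivalence.to (InJoin⇔+⟨⟩ {T} {S} S-point v)
      (InJoin-comm {S} {T} (Equivalence.from (InJoin⇔+⟨⟩ {S} {T} T-point v) v∈))

  HasSize-÷q : ∀ {S k n} → HasSize _≋_ (_∈ S) (k ℕ.* q) → HasSize _≋_ (_∈ S) (q ℕ.* n) → k ≡ n
  HasSize-÷q {k = k} {n} s₁ s₂ =
    ℕ.*-cancelʳ-≡ k n q (≡.trans (HasSize-unique ≋-isEquivalence s₁ s₂) (ℕ.*-comm q n))

module Polarities {q : ℕ} (F : FiniteField q) (m : ℕ) (P : PG.Polarity F m) where
  open Counting
  open import Data.Nat using (ℕ)
  open import Data.Product using (_,_; proj₁; proj₂)
  open import Data.Sum using (inj₁; inj₂)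
  open import Data.Empty using (⊥-elim)
  open import Relation.Nullary using (¬_)
  open import Relation.Binary.PropositionalEquality as ≡ using (_≡_)

  open Vectors F
  open Subspaces F m
  open PG.Polarity P

  ζζ⊆ : ∀ S → ζ (ζ S) ⊆ S
  ζζ⊆ S = proj₁ (involutive S)

  ⊆ζζ : ∀ S → S ⊆ ζ (ζ S)
  ⊆ζζ S = proj₂ (involutive S)

  ζ-galois : ∀ S T → S ⊆ ζ T → T ⊆ ζ S
  ζ-galois S T S⊆ζT = ⊆-trans {T} {ζ (ζ T)} {ζ S} (⊆ζζ T) (antitone S (ζ T) S⊆ζT)

  ζ-∩-⊆ : ∀ S T J → S ⊆ J → T ⊆ J → ζ (ζ S ∩ ζ T) ⊆ J
  ζ-∩-⊆ S T J S⊆J T⊆J = ⊆-trans {ζ (ζ S ∩ ζ T)} {ζ (ζ J)} {J}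
    (antitone (ζ J) (ζ S ∩ ζ T) λ v v∈ζJ →
      ∈-∩⁺ {ζ S} {ζ T} (antitone S J S⊆J v v∈ζJ) (antitone T J T⊆J v v∈ζJ))
    (ζζ⊆ J)

  -- ζ (ζ p +⟨ b ⟩) ⊆ p is either p, which would force b ∈ ζ p, or trivial, and then
  -- ζ p +⟨ b ⟩ contains ζ trivial, which is everything.
  ζ-point-hyperplane : ∀ {p b} → IsPoint p → ¬ b ∈ ζ p → ∀ v → v ∈ ζ p +⟨ b ⟩
  ζ-point-hyperplane {p} {b} p-point b∉ζp v with Point.⊆-dichotomy {p} p-point {ζ T} ζT⊆p
    where
    T = ζ p +⟨ b ⟩
    ζT⊆p : ζ T ⊆ p
    ζT⊆p = ⊆-trans {ζ T} {ζ (ζ p)} {p} (antitone (ζ p) T ⊆+⟨⟩) (ζζ⊆ p)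
  ... | inj₁ p⊆ζT = ⊥-elim (b∉ζp (ζ-galois p (ζ p +⟨ b ⟩) p⊆ζT b u∈+⟨u⟩))
  ... | inj₂ ζT⊆trivial =
    ζζ⊆ (ζ p +⟨ b ⟩) v (antitone (ζ (ζ p +⟨ b ⟩)) trivial ζT⊆trivial v v∈ζtrivial)
    where
    v∈ζtrivial : v ∈ ζ trivial
    v∈ζtrivial = ζ-galois trivial whole (trivial⊆ (ζ whole)) v ≡.refl

  HasSize-polar-section : ∀ {p T b n} → IsPoint p → b ∈ T → ¬ b ∈ ζ p →
                          HasSize _≋_ (_∈ T) (q ℕ.* n) → HasSize _≋_ (_∈ T ∩ ζ p) n
  HasSize-polar-section {p} {T} {b} p-point b∈T b∉ζp T-size =
    let (k , section-size) = sizeOf (T ∩ ζ p) in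
    ≡.subst (HasSize _≋_ (_∈ T ∩ ζ p)) (HasSize-÷q {T} (T-size′ section-size) T-size) section-size
    where
    T-size′ : ∀ {k} → HasSize _≋_ (_∈ T ∩ ζ p) k → HasSize _≋_ (_∈ T) (k ℕ.* q)
    T-size′ section-size = HasSize-cong ≋-isEquivalence
      (+⟨⟩-least {T ∩ ζ p} {b} {T} (λ v v∈ → proj₁ (∈-∩⁻ {T} {ζ p} v∈)) b∈T)
      (λ t t∈T → let (c , t≡cb) = ∈-+⟨⟩⁻ (ζ-point-hyperplane p-point b∉ζp t) in
        ∈-+⟨⟩⁺ c (⊖∈⇒≡-mod (∈-∩⁺ {T} {ζ p} (⊖∈ T t∈T (⊙∈ T c b∈T)) (≡-mod⇒⊖∈ t≡cb))))
      (HasSize-+⟨⟩ (λ b∈ → b∉ζp (proj₂ (∈-∩⁻ {T} {ζ p} b∈))) section-size)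

module PolarityGraph {q : ℕ} (F : FiniteField q) (r : ℕ) (P : PG.Polarity F (3 ℕ.+ r))
  (x* : PG.Subspace F (3 ℕ.+ r)) (x*-point : PG.IsPoint F (3 ℕ.+ r) x*)
  (x*⊈ζx* : ¬ PG._⊆_ F (3 ℕ.+ r) x* (PG.Polarity.ζ P x*)) where
  open Counting
  open import Data.Nat using (ℕ; _^_; _∸_)
  open import Data.Product using (∃; _×_; _,_; proj₁; proj₂)
  open import Data.Unit using (⊤; tt)
  open import Function using (_∘_)
  open import Function.Bundles using (_⇔_; mk⇔; Equivalence)
  import Function.Properties.Equivalence as ⇔
  open import Relation.Binary using (IsEquivalence)
  open import Relation.Nullary using (¬_; Dec; yes; map′)
  open import Relation.Binary.PropositionalEquality as ≡ using (_≡_)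

  open FiniteField F
  open Vectors F
  open Subspaces F (3 ℕ.+ r)
  open Polarities F (3 ℕ.+ r) P
  open PG.Polarity P
  open PG.Γ F (3 ℕ.+ r) P x* using (Vertex; _≈V_; Adj; R)

  H : Subspace
  H = ζ x*

  open Point {x*} x*-point using ()
    renaming (generator to a; generator∈ to a∈x*; generator∈⇒⊆ to a∈⇒x*⊆)

  a∉H : ¬ a ∈ H
  a∉H a∈H = x*⊈ζx* (a∈⇒x*⊆ {H} a∈H)

  Affine : Vector → Set
  Affine n = n ≡ a mod H

  Affine-∉H : ∀ {n} → Affine n → ¬ n ∈ H
  Affine-∉H n≡a n∈H = a∉H (∈-resp-≡-mod (mod-sym n≡a) n∈H)

  Affine-≉𝟎 : ∀ {n} → Affine n → ¬ n ≋ 𝟎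
  Affine-≉𝟎 n≡a n≋𝟎 = Affine-∉H n≡a (∈-resp-≋ H (≋-sym n≋𝟎) (𝟎∈ H))

  Affine-unique : ∀ {n n′ c} → Affine n → Affine n′ → n′ ≋ c ⊙ n → n′ ≋ n
  Affine-unique {n} {n′} {c} n≡a n′≡a n′≋cn =
    ≋-trans n′≋cn (≋-trans (⊙-cong c≈1 ≋-refl) (⊙-identityˡ n))
    where
    c≈1 : c ≈ 1#
    c≈1 = ⊙-cancel-mod a∉H (mod-trans (mod-sym (mod-⊙ c n≡a))
            (mod-trans (≋⇒≡-mod (≋-sym n′≋cn)) (mod-trans n′≡a (≋⇒≡-mod (≋-sym (⊙-identityˡ a))))))

  Affine-in : ∀ {W w} → w ∈ W → ¬ w ∈ H → ∃ λ n → Affine n × n ∈ W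
  Affine-in {W} {w} w∈W w∉H =
    let (c , a≡cw) = ∈-+⟨⟩⁻ (+⟨⟩-exchange (ζ-point-hyperplane x*-point a∉H w) w∉H)
    in c ⊙ w , mod-sym a≡cw , ⊙∈ W c w∈W

  point : Vertex → Subspace
  point = proj₁

  point-IsPoint : ∀ X → IsPoint (point X)
  point-IsPoint X = proj₁ (proj₂ X)

  point-⊈H : ∀ X → ¬ point X ⊆ H
  point-⊈H X = proj₁ (proj₂ (proj₂ X))

  gen : Vertex → Vector
  gen X = Point.generator {point X} (point-IsPoint X)

  gen∈ : ∀ X → gen X ∈ point X
  gen∈ X = Point.generator∈ {point X} (point-IsPoint X)

  gen∈⇒⊆ : ∀ X {T} → gen X ∈ T → point X ⊆ T
  gen∈⇒⊆ X {T} = Point.generator∈⇒⊆ {point X} (point-IsPoint X) {T}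

  gen∉H : ∀ X → ¬ gen X ∈ H
  gen∉H X = point-⊈H X ∘ gen∈⇒⊆ X {H}

  point⊆x*⇒⊥ : ∀ X → ¬ point X ⊆ x*
  point⊆x*⇒⊥ X x⊆x* =
    proj₂ (proj₂ (proj₂ X)) (points-⊆⇒≐ {point X} {x*} (point-IsPoint X) x*-point x⊆x*)

  x*⊆point⇒⊥ : ∀ X → ¬ x* ⊆ point X
  x*⊆point⇒⊥ X x*⊆x =
    point⊆x*⇒⊥ X (proj₂ (points-⊆⇒≐ {x*} {point X} x*-point (point-IsPoint X) x*⊆x))

  gen∉x* : ∀ X → ¬ gen X ∈ x*
  gen∉x* X = point⊆x*⇒⊥ X ∘ gen∈⇒⊆ X {x*}

  a∉point : ∀ X → ¬ a ∈ point X
  a∉point X = x*⊆point⇒⊥ X ∘ a∈⇒x*⊆ {point X}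

  a∉ζpoint : ∀ X → ¬ a ∈ ζ (point X)
  a∉ζpoint X = point-⊈H X ∘ ζ-galois x* (point X) ∘ a∈⇒x*⊆ {ζ (point X)}

  ≈V-isEquivalence : IsEquivalence _≈V_
  ≈V-isEquivalence = record
    { refl  = (λ _ v∈ → v∈) , (λ _ v∈ → v∈)
    ; sym   = λ (x⊆y , y⊆x) → y⊆x , x⊆y
    ; trans = λ (x⊆y , y⊆x) (y⊆z , z⊆y) → (λ v → y⊆z v ∘ x⊆y v) , (λ v → y⊆x v ∘ z⊆y v)
    }

  ≈V-trans : ∀ {X Y Z} → X ≈V Y → Y ≈V Z → X ≈V Z
  ≈V-trans {X} {Y} {Z} = IsEquivalence.trans ≈V-isEquivalence {X} {Y} {Z}

  representative : ∀ X → ∃ λ n → Affine n × n ∈ point X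
  representative X = Affine-in {point X} (gen∈ X) (gen∉H X)

  rep : Vertex → Vector
  rep X = proj₁ (representative X)

  rep-Affine : ∀ X → Affine (rep X)
  rep-Affine X = proj₁ (proj₂ (representative X))

  rep∈ : ∀ X → rep X ∈ point X
  rep∈ X = proj₂ (proj₂ (representative X))

  rep≉a : ∀ X → ¬ rep X ≋ a
  rep≉a X rep≋a = a∉point X (∈-resp-≋ (point X) rep≋a (rep∈ X))

  ⟨rep⟩≐point : ∀ X → ⟨ rep X ⟩ ≐ point X
  ⟨rep⟩≐point X = points-⊆⇒≐ {⟨ rep X ⟩} {point X}
    (⟨⟩-IsPoint (Affine-≉𝟎 (rep-Affine X))) (point-IsPoint X) (⟨⟩-least (point X) (rep∈ X))

  vertex : ∀ {n} → Affine n → ¬ n ≋ a → Vertex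
  vertex {n} n≡a n≉a = ⟨ n ⟩ , ⟨⟩-IsPoint (Affine-≉𝟎 n≡a) ,
    (λ ⟨n⟩⊆H → Affine-∉H n≡a (⟨n⟩⊆H n u∈+⟨u⟩)) ,
    (λ (_ , x*⊆⟨n⟩) → let (c , a≋cn) = Equivalence.to ∈⟨⟩⇔ (x*⊆⟨n⟩ a a∈x*) in
      n≉a (≋-sym (Affine-unique n≡a (≋⇒≡-mod ≋-refl) a≋cn)))

  HasSize-Affine : ∀ {W n₀ k} → Affine n₀ → n₀ ∈ W → HasSize _≋_ (_∈ W ∩ H) k →
                   HasSize _≋_ (λ n → Affine n × n ∈ W) k
  HasSize-Affine {W} {n₀} n₀≡a n₀∈W = HasSize-map {_~_ = _≋_} {_≈_ = _≋_} ≋-trans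
    (λ h _ → h ⊕ n₀)
    (λ h∈ → let (h∈W , h∈H) = ∈-∩⁻ {W} {H} h∈ in
      mod-trans (∈⇒⊕≡-mod {H} h∈H) n₀≡a , ⊕∈ W h∈W n₀∈W)
    (λ _ _ h≋h′ → ⊕-cong h≋h′ ≋-refl)
    (λ _ _ → ⊕-cancelʳ n₀)
    (λ n (n≡a , n∈W) →
      n ⊖ n₀ , ∈-∩⁺ {W} {H} (⊖∈ W n∈W n₀∈W) (≡-mod⇒⊖∈ (mod-trans n≡a (mod-sym n₀≡a))) ,
      ⊖-⊕-cancel n n₀)

  HasSize-vertices : ∀ W {k} → HasSize _≋_ (λ n → (Affine n × n ∈ W) × ¬ n ≋ a) k →
                     HasSize _≈V_ (λ Z → point Z ⊆ W) k
  HasSize-vertices W = HasSize-map {_~_ = _≋_} {_≈_ = _≈V_} (λ {X} {Y} {Z} → ≈V-trans {X} {Y} {Z})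
    (λ n ((n≡a , _) , n≉a) → vertex n≡a n≉a)
    (λ {n} ((_ , n∈W) , _) → ⟨⟩-least {n} W n∈W)
    (λ _ _ → ⟨⟩-cong)
    (λ ((n≡a , _) , _) ((n′≡a , _) , _) (_ , ⟨n′⟩⊆⟨n⟩) →
      ≋-sym (Affine-unique n≡a n′≡a (proj₂ (Equivalence.to ∈⟨⟩⇔ (⟨n′⟩⊆⟨n⟩ _ u∈+⟨u⟩)))))
    (λ Z Z⊆W → rep Z , ((rep-Affine Z , Z⊆W _ (rep∈ Z)) , rep≉a Z) , ⟨rep⟩≐point Z)

  HasSize-vertices-∌a : ∀ {W w k} → ¬ a ∈ W → w ∈ W → ¬ w ∈ H → HasSize _≋_ (_∈ W ∩ H) k →
                        HasSize _≈V_ (λ Z → point Z ⊆ W) k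
  HasSize-vertices-∌a {W} a∉W w∈W w∉H size =
    let (n₀ , n₀≡a , n₀∈W) = Affine-in {W} w∈W w∉H in
    HasSize-vertices W (HasSize-cong ≋-isEquivalence
      (λ n (n≡a , n∈W) → (n≡a , n∈W) , λ n≋a → a∉W (∈-resp-≋ W n≋a n∈W)) (λ _ → proj₁)
      (HasSize-Affine n₀≡a n₀∈W size))

  HasSize-vertices-∋a : ∀ {W k} → a ∈ W → HasSize _≋_ (_∈ W ∩ H) k →
                        HasSize _≈V_ (λ Z → point Z ⊆ W) (k ∸ 1)
  HasSize-vertices-∋a {W} a∈W size = HasSize-vertices W
    (HasSize-remove ≋-isEquivalence (≋⇒≡-mod ≋-refl , a∈W)
      (HasSize-Affine (≋⇒≡-mod ≋-refl) a∈W size))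

  line : Vertex → Subspace
  line X = x* +⟨ gen X ⟩

  point⊆line : ∀ X → point X ⊆ line X
  point⊆line X = gen∈⇒⊆ X {line X} u∈+⟨u⟩

  InJoin⇔line : ∀ X w → InJoin x* (point X) w ⇔ w ∈ line X
  InJoin⇔line X = InJoin⇔+⟨⟩ {x*} {point X} (point-IsPoint X)

  R⇒gen∈line : ∀ X Y → R X Y → gen Y ∈ line X
  R⇒gen∈line X Y XRY = Equivalence.to (InJoin⇔line X (gen Y))
    (Equivalence.from (XRY (gen Y)) (Equivalence.from (InJoin⇔line Y (gen Y)) u∈+⟨u⟩))

  gen∈line⇒R : ∀ X Y → gen Y ∈ line X → R X Y
  gen∈line⇒R X Y gY∈ w = mk⇔ (transfer X Y lineX⊆lineY) (transfer Y X lineY⊆lineX)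
    where
    lineY⊆lineX : line Y ⊆ line X
    lineY⊆lineX = +⟨⟩-least {x*} {gen Y} {line X} ⊆+⟨⟩ gY∈
    lineX⊆lineY : line X ⊆ line Y
    lineX⊆lineY = +⟨⟩-least {x*} {gen X} {line Y} ⊆+⟨⟩ (+⟨⟩-exchange gY∈ (gen∉x* Y))
    transfer : ∀ X Y → line X ⊆ line Y → InJoin x* (point X) w → InJoin x* (point Y) w
    transfer X Y lineX⊆lineY =
      Equivalence.from (InJoin⇔line Y w) ∘ lineX⊆lineY w ∘ Equivalence.to (InJoin⇔line X w)

  R-isEquivalence : IsEquivalence R
  R-isEquivalence = record
    { refl  = λ _ → ⇔.refl
    ; sym   = λ XRY w → ⇔.sym (XRY w)
    ; trans = λ XRY YRZ w → ⇔.trans (XRY w) (YRZ w)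
    }

  R? : ∀ X Y → Dec (R X Y)
  R? X Y = map′ (gen∈line⇒R X Y) (R⇒gen∈line X Y) (gen Y ∈? line X)

  ≈V⇒R : ∀ X Y → X ≈V Y → R X Y
  ≈V⇒R X Y (_ , y⊆x) = gen∈line⇒R X Y (point⊆line X _ (y⊆x _ (gen∈ Y)))

  R⇔⊆line : ∀ X Z → R X Z ⇔ point Z ⊆ line X
  R⇔⊆line X Z =
    mk⇔ (gen∈⇒⊆ Z {line X} ∘ R⇒gen∈line X Z) (λ z⊆line → gen∈line⇒R X Z (z⊆line _ (gen∈ Z)))

  Adj⇔⊆ζ : ∀ X Z → Adj X Z ⇔ point Z ⊆ ζ (point X)
  Adj⇔⊆ζ X Z = mk⇔ (ζ-galois (point X) (point Z)) (ζ-galois (point Z) (point X))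

  R⇒a∈join : ∀ X Y → R X Y → ¬ X ≈V Y → a ∈ point X +⟨ gen Y ⟩
  R⇒a∈join X Y XRY X≉Y =
    +⟨⟩-exchange (join-comm {x*} {point X} x*-point (point-IsPoint X) (R⇒gen∈line X Y XRY)) gY∉x
    where
    gY∉x : ¬ gen Y ∈ point X
    gY∉x gY∈x = X≉Y (IsEquivalence.sym ≈V-isEquivalence {Y} {X}
      (points-⊆⇒≐ {point Y} {point X} (point-IsPoint Y) (point-IsPoint X) (gen∈⇒⊆ Y {point X} gY∈x)))

  a∈join⇒R : ∀ X Y → a ∈ point X +⟨ gen Y ⟩ → R X Y
  a∈join⇒R X Y a∈ = gen∈line⇒R X Y
    (join-comm {point X} {x*} (point-IsPoint X) x*-point (+⟨⟩-exchange a∈ (a∉point X)))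

  no-common-neighbour : ∀ X Y → R X Y → ¬ X ≈V Y → ∀ Z → ¬ (Adj X Z × Adj Y Z)
  no-common-neighbour X Y XRY X≉Y Z (x⊆ζz , y⊆ζz) = point-⊈H Z
    (ζ-galois x* (point Z) (a∈⇒x*⊆ {ζ (point Z)}
      (+⟨⟩-least {point X} {gen Y} {ζ (point Z)} x⊆ζz (y⊆ζz _ (gen∈ Y)) a (R⇒a∈join X Y XRY X≉Y))))

  x*-size : HasSize _≋_ (_∈ x*) (1 ℕ.* q)
  x*-size = HasSize-cong ≋-isEquivalence (⟨⟩-least x* a∈x*) (a∈⇒x*⊆ {⟨ a ⟩} u∈+⟨u⟩)
    (HasSize-+⟨⟩ {trivial} {a} (Point.generator≉𝟎 {x*} x*-point ∘ ∈-trivial⁻) HasSize-trivial)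

  line-size : ∀ X → HasSize _≋_ (_∈ line X) (q ℕ.* q)
  line-size X = ≡.subst (HasSize _≋_ (_∈ line X)) (≡.cong (ℕ._* q) (ℕ.*-identityˡ q))
    (HasSize-+⟨⟩ {x*} {gen X} (gen∉x* X) x*-size)

  H-size : HasSize _≋_ (_∈ whole ∩ H) (q ^ (2 ℕ.+ r))
  H-size = HasSize-polar-section {x*} {whole} {a} x*-point ≡.refl a∉H HasSize-whole

  neighbourhood-size : ∀ X → HasSize _≋_ (_∈ H ∩ ζ (point X)) (q ^ (1 ℕ.+ r))
  neighbourhood-size X =
    let (b , b∈H , b∉ζx) = ⊈⇒∃∉ {H} {ζ (point X)} H⊈ζx in
    HasSize-polar-section {point X} {H} {b} (point-IsPoint X) b∈H b∉ζx
      (HasSize-cong ≋-isEquivalence (λ v → proj₂ ∘ ∈-∩⁻ {whole} {H}) (λ v → ∈-∩⁺ {whole} {H} ≡.refl)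
                    H-size)
    where
    H⊈ζx : ¬ H ⊆ ζ (point X)
    H⊈ζx H⊆ζx =
      point⊆x*⇒⊥ X (⊆-trans {point X} {ζ H} {x*} (ζ-galois H (point X) H⊆ζx) (ζζ⊆ x*))

  common-size : ∀ X Y → ¬ R X Y → HasSize _≋_ (_∈ (H ∩ ζ (point X)) ∩ ζ (point Y)) (q ^ r)
  common-size X Y ¬XRY =
    let (b , b∈ , b∉ζy) = ⊈⇒∃∉ {H ∩ ζ (point X)} {ζ (point Y)} ⊈ζy in
    HasSize-polar-section {point Y} {H ∩ ζ (point X)} {b} (point-IsPoint Y) b∈ b∉ζy (neighbourhood-size X)
    where
    ⊈ζy : ¬ H ∩ ζ (point X) ⊆ ζ (point Y)
    ⊈ζy ⊆ζy = ¬XRY (gen∈line⇒R X Y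
      (ζ-∩-⊆ x* (point X) (line X) (⊆+⟨⟩ {x*} {gen X}) (point⊆line X) (gen Y)
        (ζ-galois (H ∩ ζ (point X)) (point Y) ⊆ζy (gen Y) (gen∈ Y))))

  vertices-size : HasSize _≈V_ (λ _ → ⊤) (q ^ (2 ℕ.+ r) ∸ 1)
  vertices-size = HasSize-cong ≈V-isEquivalence (λ _ _ → tt) (λ _ _ _ _ → ≡.refl)
    (HasSize-vertices-∋a {whole} ≡.refl H-size)

  neighbours-size : ∀ X → HasSize _≈V_ (Adj X) (q ^ (1 ℕ.+ r))
  neighbours-size X =
    let (w , w∈ζx , w∉H) = ⊈⇒∃∉ {ζ (point X)} {H} ζx⊈H in
    HasSize-⇔ ≈V-isEquivalence (λ Z → ⇔.sym (Adj⇔⊆ζ X Z))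
      (HasSize-vertices-∌a {ζ (point X)} (a∉ζpoint X) w∈ζx w∉H
        (HasSize-cong ≋-isEquivalence (∩-comm H (ζ (point X))) (∩-comm (ζ (point X)) H)
                      (neighbourhood-size X)))
    where
    ζx⊈H : ¬ ζ (point X) ⊆ H
    ζx⊈H ζx⊆H = x*⊆point⇒⊥ X
      (⊆-trans {x*} {ζ (ζ (point X))} {point X} (ζ-galois (ζ (point X)) x* ζx⊆H) (ζζ⊆ (point X)))

  common-neighbours-size : ∀ X Y → ¬ R X Y → HasSize _≈V_ (λ Z → Adj X Z × Adj Y Z) (q ^ r)
  common-neighbours-size X Y ¬XRY =
    let (w , w∈ , w∉H) = ⊈⇒∃∉ {ζx ∩ ζy} {H} ⊈H in
    HasSize-cong ≈V-isEquivalence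
      (λ Z z⊆ → Equivalence.from (Adj⇔⊆ζ X Z) (λ v → proj₁ ∘ ∈-∩⁻ {ζx} {ζy} ∘ z⊆ v) ,
                Equivalence.from (Adj⇔⊆ζ Y Z) (λ v → proj₂ ∘ ∈-∩⁻ {ζx} {ζy} ∘ z⊆ v))
      (λ Z (adjX , adjY) v v∈z → ∈-∩⁺ {ζx} {ζy} (Equivalence.to (Adj⇔⊆ζ X Z) adjX v v∈z)
                                               (Equivalence.to (Adj⇔⊆ζ Y Z) adjY v v∈z))
      (HasSize-vertices-∌a {ζx ∩ ζy} (a∉ζpoint X ∘ proj₁ ∘ ∈-∩⁻ {ζx} {ζy}) w∈ w∉H
        (HasSize-cong ≋-isEquivalence reassoc reassoc⁻ (common-size X Y ¬XRY)))
    where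
    ζx = ζ (point X)
    ζy = ζ (point Y)
    ⊈H : ¬ ζx ∩ ζy ⊆ H
    ⊈H ⊆H = ¬XRY (a∈join⇒R X Y
      (ζ-∩-⊆ (point X) (point Y) (point X +⟨ gen Y ⟩)
        (⊆+⟨⟩ {point X} {gen Y}) (gen∈⇒⊆ Y {point X +⟨ gen Y ⟩} u∈+⟨u⟩) a
        (ζ-galois (ζx ∩ ζy) x* ⊆H a a∈x*)))
    reassoc : ∀ v → v ∈ (H ∩ ζx) ∩ ζy → v ∈ (ζx ∩ ζy) ∩ H
    reassoc v v∈ =
      let (v∈H∩ζx , v∈ζy) = ∈-∩⁻ {H ∩ ζx} {ζy} v∈ ; (v∈H , v∈ζx) = ∈-∩⁻ {H} {ζx} v∈H∩ζx in
      ∈-∩⁺ {ζx ∩ ζy} {H} (∈-∩⁺ {ζx} {ζy} v∈ζx v∈ζy) v∈H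
    reassoc⁻ : ∀ v → v ∈ (ζx ∩ ζy) ∩ H → v ∈ (H ∩ ζx) ∩ ζy
    reassoc⁻ v v∈ =
      let (v∈ζx∩ζy , v∈H) = ∈-∩⁻ {ζx ∩ ζy} {H} v∈ ; (v∈ζx , v∈ζy) = ∈-∩⁻ {ζx} {ζy} v∈ζx∩ζy in
      ∈-∩⁺ {H ∩ ζx} {ζy} (∈-∩⁺ {H} {ζx} v∈H v∈ζx) v∈ζy

  class-size : ∀ X → HasSize _≈V_ (R X) (q ∸ 1)
  class-size X = HasSize-⇔ ≈V-isEquivalence (λ Z → ⇔.sym (R⇔⊆line X Z))
    (HasSize-vertices-∋a {line X} a∈line
      (HasSize-polar-section {x*} {line X} {a} x*-point a∈line a∉H (line-size X)))
    where
    a∈line : a ∈ line X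
    a∈line = ⊆+⟨⟩ {x*} {gen X} a a∈x*

  classes : ∃ λ c → HasSize R (λ _ → ⊤) c
  classes = let (f , _ , _ , f-onto) = vertices-size in
    enumerable⇒HasSize R-isEquivalence R? (λ _ → yes tt) (λ _ _ → tt) f
      (λ Y _ → let (i , fᵢ≈Y) = f-onto Y tt in i , ≈V⇒R (f i) Y fᵢ≈Y)

  isLDDG : IsLDDG _≈V_ Adj R (q ^ (2 ℕ.+ r) ∸ 1) (q ^ (1 ℕ.+ r)) 0 (q ^ r) (proj₁ classes) (q ∸ 1)
  isLDDG = record
    { vertices   = vertices-size
    ; regular    = neighbours-size
    ; partition  = R-isEquivalence
    ; classSize  = class-size
    ; numClasses = let (f , _ , f-inj , f-onto) = proj₂ classes in f , f-inj , λ Y → f-onto Y tt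
    ; sameClass  = λ X Y XRY X≉Y → HasSize-∅ ≈V-isEquivalence (no-common-neighbour X Y XRY X≉Y)
    ; diffClass  = common-neighbours-size
    }

  2≤classes : 1 ℕ.< q → 2 ℕ.≤ proj₁ classes
  2≤classes 1<q = 2≤#classes ≈V-isEquivalence vertices-size class-size q∸1<v (proj₂ classes)
    where
    q∸1<v : q ∸ 1 ℕ.< q ^ (2 ℕ.+ r) ∸ 1
    q∸1<v = ℕ.∸-monoˡ-< (ℕ.m<m*n q (q ^ (1 ℕ.+ r)) (ℕ.^-monoʳ-< q 1<q {0} {1 ℕ.+ r} (ℕ.s≤s ℕ.z≤n)))
                        (ℕ.<⇒≤ 1<q)

theorem1p3 : (m q : ℕ) → 3 ≤ m → 3 ≤ q → (F : FiniteField q) →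
    (P : PG.Polarity F m) → (x* : PG.Subspace F m) →
    PG.IsPoint F m x* → ¬ (PG._⊆_ F m x* (PG.Polarity.ζ P x*)) →
    ∃ λ v → ∃ λ k → ∃ λ λ₁ → ∃ λ λ₂ → ∃ λ mc → ∃ λ n →
    IsProperLDDG (PG.Γ._≈V_ F m P x*) (PG.Γ.Adj F m P x*) (PG.Γ.R F m P x*)
    v k λ₁ λ₂ mc n
theorem1p3 (ℕ.suc (ℕ.suc (ℕ.suc r))) q@(ℕ.suc (ℕ.suc (ℕ.suc _)))
           (ℕ.s≤s (ℕ.s≤s (ℕ.s≤s _))) (ℕ.s≤s (ℕ.s≤s (ℕ.s≤s _))) F P x* x*-point x*⊈ζx* =
  q ℕ.^ (2 ℕ.+ r) ℕ.∸ 1 , q ℕ.^ (1 ℕ.+ r) , 0 , q ℕ.^ r , proj₁ classes , q ℕ.∸ 1 , record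
    { lddg  = isLDDG
    ; m≥2   = 2≤classes (ℕ.s≤s (ℕ.s≤s ℕ.z≤n))
    ; n≥2   = ℕ.s≤s (ℕ.s≤s ℕ.z≤n)
    ; λ₁≢λ₂ = ℕ.<⇒≢ (ℕ.m^n>0 q r)
    }
  where open PolarityGraph F r P x* x*-point x*⊈ζx*
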